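{- Let $a,b,k$ be positive integers. The language $\mathcal C^{a,b\Rightarrow k}\subset\{m,\overline m\}^*$ of culminating words whose final height is $k$ is a regular language.
   Context: Fix positive integers $a,b$. Words over the alphabet $\{m,\overline m\}$ encode lattice walks starting at height $0$: each letter $m$ is an up step $+a$ and each letter $\overline m$ a down step $-b$. For a word $w$, $\phi_{a,b}(w)=a|w|_m-b|w|_{\overline m}$ is the final height of the corresponding walk, where $|w|_x$ is the number of occurrences of the letter $x$ in $w$. A word $w$ is culminating if $\phi_{a,b}(w')>0$ for every non-empty prefix $w'$ of $w$ (positivity), and $\phi_{a,b}(w')<\phi_{a,b}(w)$ for every proper prefix $w'$ of $w$ (final record). $\mathcal C^{a,b\Rightarrow k}$ is the set of culminating words $w$ with $\phi_{a,b}(w)=k$. -}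

module Defs where

open import Data.Nat using (ℕ)
open import Data.Integer as ℤ using (ℤ; +_; _-_; _<_)
open import Data.List using (List; []; _∷_; _++_; foldl)
open import Data.Fin using (Fin)
open import Data.Bool using (Bool; true)
open import Data.Product using (_×_; Σ; ∃)
open import Relation.Binary.PropositionalEquality using (_≡_; _≢_)
open import Function.Bundles using (_⇔_)

data Letter : Set where
  m  : Letter
  m̄ : Letter

Word : Set
Word = List Letter

count-m : Word → ℕ
count-m [] = 0
count-m (m ∷ w) = Data.Nat.suc (count-m w)
count-m (m̄ ∷ w) = count-m w

count-m̄ : Word → ℕ
count-m̄ [] = 0
count-m̄ (m ∷ w) = count-m̄ w
count-m̄ (m̄ ∷ w) = Data.Nat.suc (count-m̄ w)

φ : ℕ → ℕ → Word → ℤ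
φ a b w = + (a Data.Nat.* count-m w) - + (b Data.Nat.* count-m̄ w)

-- Culminating: positivity on non-empty prefixes, and final record on
-- proper prefixes (w' ++ v ≡ w with v non-empty, including w' = []).
Culminating : ℕ → ℕ → Word → Set
Culminating a b w =
  (∀ (w' v : Word) → w' ++ v ≡ w → w' ≢ [] → + 0 < φ a b w')
  × (∀ (w' v : Word) → w' ++ v ≡ w → v ≢ [] → φ a b w' < φ a b w)

C : ℕ → ℕ → ℕ → Word → Set
C a b k w = Culminating a b w × φ a b w ≡ + k

record DFA : Set where
  field
    size   : ℕ
    δ      : Fin size → Letter → Fin size
    start  : Fin size
    accept : Fin size → Bool

open DFA public

run : (D : DFA) → Fin (size D) → Word → Fin (size D)
run D q w = foldl (δ D) q w

Accepts : DFA → Word → Set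
Accepts D w = accept D (run D (start D) w) ≡ true

Regular : (Word → Set) → Set
Regular L = Σ DFA (λ D → ∀ (w : Word) → L w ⇔ Accepts D w)

-- Before every letter a word of C^{a,b⇒k} is at a height strictly below its final height k,
-- and after every letter its height is positive; so along the walk the height stays in
-- [0, k]. Reading the word letter by letter while remembering only the current height
-- (and falling into a dead state as soon as one of the two constraints fails) is a DFA
-- with k + 2 states.
module Submission where

open import Defs
open import Data.Nat as ℕ using (ℕ; _<_; _≤_; suc; s≤s; _≡ᵇ_)
import Data.Nat.Properties as ℕ
open import Data.Integer as ℤ using (ℤ; +_; 0ℤ; 1ℤ; ∣_∣; +≤+; _+_; _-_; _*_; -_)
open import Data.Integer.Properties as ℤ
  using (pos-*; +-identityˡ; +-identityʳ; +-assoc; +-injective; 0≤i⇒+∣i∣≡i; drop‿+<+)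
open import Data.Integer.Tactic.RingSolver using (solve-∀)
open import Data.List using (List; []; _∷_; _++_; foldl)
open import Data.List.Properties using (++-conicalˡ; ++-conicalʳ; ∷-injectiveˡ; ∷-injectiveʳ)
open import Data.Fin using (Fin; toℕ; fromℕ<)
open import Data.Fin.Properties using (toℕ-fromℕ<)
open import Data.Bool using (Bool; true; T)
open import Data.Bool.Properties using (T-≡)
open import Data.Product using (_×_; _,_; proj₁; proj₂)
open import Data.Empty using (⊥-elim)
open import Level using (0ℓ)
open import Relation.Nullary using (Dec; yes; no; _×-dec_)
open import Relation.Binary.PropositionalEquality
open import Function.Bundles using (_⇔_; mk⇔; Equivalence)
open import Function.Properties.Equivalence using (⇔-setoid)
open import Function.Construct.Symmetry using (⇔-sym)

open Equivalence using (to; from)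

module _ (N : ℕ) (δℕ : ℕ → Letter → ℕ) (δℕ-≤ : ∀ n x → δℕ n x ≤ N) (acceptℕ : ℕ → Bool) where

  boundedDFA : DFA
  boundedDFA = record
    { size   = suc N
    ; δ      = λ q x → fromℕ< (s≤s (δℕ-≤ (toℕ q) x))
    ; start  = Fin.zero
    ; accept = λ q → acceptℕ (toℕ q)
    }

  toℕ-run : ∀ q w → toℕ (run boundedDFA q w) ≡ foldl δℕ (toℕ q) w
  toℕ-run q []      = refl
  toℕ-run q (x ∷ w) =
    trans (toℕ-run _ w) (cong (λ n → foldl δℕ n w) (toℕ-fromℕ< (s≤s (δℕ-≤ (toℕ q) x))))

  Accepts-boundedDFA : ∀ w → Accepts boundedDFA w ⇔ acceptℕ (foldl δℕ 0 w) ≡ true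
  Accepts-boundedDFA w = mk⇔ (trans (sym eq)) (trans eq)
    where
    eq : accept boundedDFA (run boundedDFA Fin.zero w) ≡ acceptℕ (foldl δℕ 0 w)
    eq = cong acceptℕ (toℕ-run Fin.zero w)

∣i∣≤n : ∀ {i n} → 0ℤ ℤ.≤ i → i ℤ.≤ + n → ∣ i ∣ ≤ n
∣i∣≤n (+≤+ _) (+≤+ i≤n) = i≤n

module _ (a b : ℕ) where

  step : Letter → ℤ
  step m  = + a
  step m̄ = - + b

  height : ℤ → Word → ℤ
  height h w = h + φ a b w

  φ-as-sum : ∀ w → φ a b w ≡ + a * + count-m w - + b * + count-m̄ w
  φ-as-sum w = cong₂ _-_ (pos-* a (count-m w)) (pos-* b (count-m̄ w))

  φ-[] : φ a b [] ≡ 0ℤ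
  φ-[] = cong₂ (λ p q → + p - + q) (ℕ.*-zeroʳ a) (ℕ.*-zeroʳ b)

  φ-∷ : ∀ x w → φ a b (x ∷ w) ≡ step x + φ a b w
  φ-∷ m w = trans (φ-as-sum (m ∷ w))
    (trans (up (+ a) (+ count-m w) (+ b) (+ count-m̄ w))
           (cong (_+_ (step m)) (sym (φ-as-sum w))))
    where
    up : ∀ i j k l → i * (1ℤ + j) - k * l ≡ i + (i * j - k * l)
    up = solve-∀
  φ-∷ m̄ w = trans (φ-as-sum (m̄ ∷ w))
    (trans (down (+ a) (+ count-m w) (+ b) (+ count-m̄ w))
           (cong (_+_ (step m̄)) (sym (φ-as-sum w))))
    where
    down : ∀ i j k l → i * j - k * (1ℤ + l) ≡ - k + (i * j - k * l)
    down = solve-∀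

  height-[] : ∀ h → height h [] ≡ h
  height-[] h = trans (cong (_+_ h) φ-[]) (+-identityʳ h)

  height-∷ : ∀ h x w → height h (x ∷ w) ≡ height (h + step x) w
  height-∷ h x w = trans (cong (_+_ h) (φ-∷ x w)) (sym (+-assoc h (step x) (φ a b w)))

  module _ (k : ℕ) where

    CulminatingFrom : ℤ → Word → Set
    CulminatingFrom h w =
        (∀ w' v → w' ++ v ≡ w → w' ≢ [] → 0ℤ ℤ.< height h w')
      × (∀ w' v → w' ++ v ≡ w → v ≢ [] → height h w' ℤ.< height h w)
      × height h w ≡ + k

    Climbs : ℤ → Word → Set
    Climbs h []      = h ≡ + k
    Climbs h (x ∷ w) = h ℤ.< + k × 0ℤ ℤ.< h + step x × Climbs (h + step x) w

    C⇔CulminatingFrom0 : ∀ w → C a b k w ⇔ CulminatingFrom 0ℤ w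
    C⇔CulminatingFrom0 w = mk⇔
      (λ ((pos , rec) , end) →
          (λ w' v eq ne → subst (0ℤ ℤ.<_) (sym (h0 w')) (pos w' v eq ne))
        , (λ w' v eq ne → subst₂ ℤ._<_ (sym (h0 w')) (sym (h0 w)) (rec w' v eq ne))
        , trans (h0 w) end)
      (λ (pos , rec , end) →
          ( (λ w' v eq ne → subst (0ℤ ℤ.<_) (h0 w') (pos w' v eq ne))
          , (λ w' v eq ne → subst₂ ℤ._<_ (h0 w') (h0 w) (rec w' v eq ne)))
        , trans (sym (h0 w)) end)
      where
      h0 : ∀ u → height 0ℤ u ≡ φ a b u
      h0 u = +-identityˡ (φ a b u)

    CulminatingFrom⇒Climbs : ∀ h w → CulminatingFrom h w → Climbs h w
    CulminatingFrom⇒Climbs h []      (_ , _ , end) = trans (sym (height-[] h)) end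
    CulminatingFrom⇒Climbs h (x ∷ w) (pos , rec , end) =
        subst₂ ℤ._<_ (height-[] h) end (rec [] (x ∷ w) refl λ ())
      , subst (0ℤ ℤ.<_) (trans (height-∷ h x []) (height-[] _)) (pos (x ∷ []) w refl λ ())
      , CulminatingFrom⇒Climbs (h + step x) w
          ( (λ w' v eq ne → subst (0ℤ ℤ.<_) (height-∷ h x w') (pos (x ∷ w') v (cong (x ∷_) eq) λ ()))
          , (λ w' v eq ne → subst₂ ℤ._<_ (height-∷ h x w') (height-∷ h x w)
                                         (rec (x ∷ w') v (cong (x ∷_) eq) ne))
          , trans (sym (height-∷ h x w)) end)

    Climbs⇒CulminatingFrom : ∀ h w → Climbs h w → CulminatingFrom h w
    Climbs⇒CulminatingFrom h [] end =
        (λ w' v eq ne → ⊥-elim (ne (++-conicalˡ w' v eq)))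
      , (λ w' v eq ne → ⊥-elim (ne (++-conicalʳ w' v eq)))
      , trans (height-[] h) end
    Climbs⇒CulminatingFrom h (x ∷ w) (below , positive , climbs) = pos , rec , end
      where
      h' : ℤ
      h' = h + step x
      ih : CulminatingFrom h' w
      ih = Climbs⇒CulminatingFrom h' w climbs
      end : height h (x ∷ w) ≡ + k
      end = trans (height-∷ h x w) (proj₂ (proj₂ ih))
      pos : ∀ w' v → w' ++ v ≡ x ∷ w → w' ≢ [] → 0ℤ ℤ.< height h w'
      pos []       v eq ne = ⊥-elim (ne refl)
      pos (y ∷ []) v eq ne rewrite ∷-injectiveˡ eq =
        subst (0ℤ ℤ.<_) (sym (trans (height-∷ h x []) (height-[] h'))) positive
      pos (y ∷ u@(_ ∷ _)) v eq ne rewrite ∷-injectiveˡ eq =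
        subst (0ℤ ℤ.<_) (sym (height-∷ h x u)) (proj₁ ih u v (∷-injectiveʳ eq) λ ())
      rec : ∀ w' v → w' ++ v ≡ x ∷ w → v ≢ [] → height h w' ℤ.< height h (x ∷ w)
      rec []      v eq ne = subst₂ ℤ._<_ (sym (height-[] h)) (sym end) below
      rec (y ∷ u) v eq ne rewrite ∷-injectiveˡ eq =
        subst₂ ℤ._<_ (sym (height-∷ h x u)) (sym (height-∷ h x w))
          (proj₁ (proj₂ ih) u v (∷-injectiveʳ eq) ne)

    CulminatingFrom⇔Climbs : ∀ h w → CulminatingFrom h w ⇔ Climbs h w
    CulminatingFrom⇔Climbs h w = mk⇔ (CulminatingFrom⇒Climbs h w) (Climbs⇒CulminatingFrom h w)

    Climbs-≤ : ∀ h w → Climbs h w → h ℤ.≤ + k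
    Climbs-≤ h []      end         = ℤ.≤-reflexive end
    Climbs-≤ h (x ∷ w) (below , _) = ℤ.<⇒≤ below

    Admissible : ℤ → ℤ → Set
    Admissible g h = g ℤ.< + k × 0ℤ ℤ.< h × h ℤ.≤ + k

    admissible? : ∀ g h → Dec (Admissible g h)
    admissible? g h = (g ℤ.<? + k) ×-dec (0ℤ ℤ.<? h) ×-dec (h ℤ.≤? + k)

    -- Heights 0, …, k are states; suc k is the dead state.
    next : ℕ → Letter → ℕ
    next n x with admissible? (+ n) (+ n + step x)
    ... | yes _ = ∣ + n + step x ∣
    ... | no _  = suc k

    next-≤ : ∀ n x → next n x ≤ suc k
    next-≤ n x with admissible? (+ n) (+ n + step x)
    ... | yes (_ , positive , atMost) = ℕ.m≤n⇒m≤1+n (∣i∣≤n (ℤ.<⇒≤ positive) atMost)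
    ... | no _                        = ℕ.≤-refl

    next-dead : ∀ x → next (suc k) x ≡ suc k
    next-dead x with admissible? (+ suc k) (+ suc k + step x)
    ... | yes (below , _) = ⊥-elim (ℕ.<-asym (ℕ.n<1+n k) (drop‿+<+ below))
    ... | no _            = refl

    foldl-next-dead : ∀ w → foldl next (suc k) w ≡ suc k
    foldl-next-dead []      = refl
    foldl-next-dead (x ∷ w) rewrite next-dead x = foldl-next-dead w

    foldl-next-dead≢k : ∀ w → foldl next (suc k) w ≢ k
    foldl-next-dead≢k w eq = ℕ.n≮n k (subst (k <_) (trans (sym (foldl-next-dead w)) eq) (ℕ.n<1+n k))

    foldl-next⇔Climbs : ∀ n w → foldl next n w ≡ k ⇔ Climbs (+ n) w
    foldl-next⇔Climbs n []      = mk⇔ (cong (λ j → + j)) +-injective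
    foldl-next⇔Climbs n (x ∷ w) with admissible? (+ n) (+ n + step x)
    ... | yes (below , positive , atMost) = mk⇔
            (λ reaches → below , positive , subst (λ g → Climbs g w) ∣h∣≡h (to ih reaches))
            (λ (_ , _ , climbs) → from ih (subst (λ g → Climbs g w) (sym ∣h∣≡h) climbs))
      where
      ∣h∣≡h : + ∣ + n + step x ∣ ≡ + n + step x
      ∣h∣≡h = 0≤i⇒+∣i∣≡i (ℤ.<⇒≤ positive)
      ih : foldl next ∣ + n + step x ∣ w ≡ k ⇔ Climbs (+ ∣ + n + step x ∣) w
      ih = foldl-next⇔Climbs ∣ + n + step x ∣ w
    ... | no inadmissible = mk⇔
            (λ reaches → ⊥-elim (foldl-next-dead≢k w reaches))
            (λ (below , positive , climbs) →
               ⊥-elim (inadmissible (below , positive , Climbs-≤ _ w climbs)))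

    automaton : DFA
    automaton = boundedDFA (suc k) next next-≤ (_≡ᵇ k)

    C⇔Accepts : ∀ w → C a b k w ⇔ Accepts automaton w
    C⇔Accepts w = begin
      C a b k w                     ≈⟨ C⇔CulminatingFrom0 w ⟩
      CulminatingFrom 0ℤ w          ≈⟨ CulminatingFrom⇔Climbs 0ℤ w ⟩
      Climbs 0ℤ w                   ≈⟨ ⇔-sym (foldl-next⇔Climbs 0 w) ⟩
      foldl next 0 w ≡ k            ≈⟨ mk⇔ (ℕ.≡⇒≡ᵇ _ k) (ℕ.≡ᵇ⇒≡ _ k) ⟩
      T (foldl next 0 w ≡ᵇ k)       ≈⟨ T-≡ ⟩
      (foldl next 0 w ≡ᵇ k) ≡ true  ≈⟨ ⇔-sym (Accepts-boundedDFA (suc k) next next-≤ (_≡ᵇ k) w) ⟩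
      Accepts automaton w           ∎
      where open import Relation.Binary.Reasoning.Setoid (⇔-setoid 0ℓ)

proposition2p1 : (a b k : ℕ) → 0 < a → 0 < b → 0 < k → Regular (C a b k)
proposition2p1 a b k _ _ _ = automaton a b k , C⇔Accepts a b k
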